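{- Let $D$ be a digraph whose unique strong component with more than one vertex, $D'$, is a subdivision of a vault without a niche, with walls $P_0,\dots,P_{\ell-1}$ of $D'$ as defined in the context. Let $\alpha\in V(D)\setminus V(D')$ and let $u\neq v$ be neighbors of $\alpha$ in $\mathrm{UG}(D)$ such that $u,v$ lie on the same wall $P_i$, or on walls $P_i,P_j$ with $j\notin\{i-1,i,i+1\}$ (mod $\ell$). Then $(\{u,v\},\alpha)$ is a $1$-clasp.
   Context: Digraphs are finite, loops and multiple arcs allowed; a dicycle is a directed cycle of $D$, a cycle is a cycle of $\mathrm{UG}(D)$. Vertices of $V(D)\setminus V(D')$ are called external. For $k\ge 1$, a pair $(\{u,v\},\alpha)$ is a $k$-clasp if $\alpha$ is external, $u,v$ are neighbors of $\alpha$, and there is a cycle $C^*$ in $\mathrm{UG}(D)$ containing $u,v,\alpha$ and at most $k$ external vertices, together with a dicycle $B^*$ in $D$ with $V(B^*)\cap V(C^*)=\emptyset$. Vault: let $\ell\ge 5$ be odd, $P_0,\dots,P_{\ell-1}$ disjoint nonempty dipaths, $a_i$ the initial and $d_i$ the terminal vertex of $P_i$, and $b_i,c_i$ vertices of $P_i$ with either $b_ic_i$ an arc of $P_i$ or $b_i=c_i\in\{a_i,d_i\}$. A vault is obtained from the disjoint union of the $P_i$ by adding, for every $i$ (indices mod $\ell$), at least one arc from some vertex of $P_i[c_i,d_i]$ to some vertex of $P_{i+1}[a_{i+1},b_{i+1}]$ (multiple arcs allowed) and a single arc from $d_i$ to $a_{i+2}$, and no further arcs. It has a niche if there are arcs $pq,rs$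 from some $P_i$ to $P_{i+1}$ with $p$ before $r$ on $P_i$ and $q$ after $s$ on $P_{i+1}$. A subdivision replaces each arc $pq$ by a $(p,q)$-dipath (its link) with new internal vertices. The wall $P_i$ of $D'$ is the dipath consisting of the subdivided wall $P_i$ followed by the link of $d_ia_{i+2}$ minus $a_{i+2}$. -}

module Defs where

open import Data.Nat using (ℕ; zero; suc; _+_; _*_; _≤_; _<_)
open import Data.Nat.DivMod using (_%_; m%n<n)
open import Data.Fin using (Fin; toℕ; fromℕ<; fromℕ; inject₁) renaming (zero to fzero; suc to fsuc)
open import Data.Bool using (Bool; true; false; not)
open import Data.List using (List; []; _∷_; length; filterᵇ)
open import Data.List.Membership.Propositional using (_∈_)
open import Data.List.Relation.Unary.Unique.Propositional using (Unique)
open import Data.Product using (Σ; ∃; ∃-syntax; _×_; _,_)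
open import Data.Sum using (_⊎_)
open import Relation.Binary.PropositionalEquality using (_≡_; _≢_)
open import Relation.Nullary using (¬_)

record Digraph : Set where
  field
    V  : ℕ
    A  : ℕ
    tl : Fin A → Fin V
    hd : Fin A → Fin V
open Digraph public

module _ (D : Digraph) where

  IsWalk : Fin (V D) → List (Fin (A D)) → Fin (V D) → Set
  IsWalk x []       y = x ≡ y
  IsWalk x (a ∷ as) y = tl D a ≡ x × IsWalk (hd D a) as y

  verts : Fin (V D) → List (Fin (A D)) → List (Fin (V D))
  verts x []       = x ∷ []
  verts x (a ∷ as) = x ∷ verts (hd D a) as

  IsDipath : Fin (V D) → List (Fin (A D)) → Fin (V D) → Set
  IsDipath x as y = IsWalk x as y × Unique (verts x as)

  Reach : Fin (V D) → Fin (V D) → Set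
  Reach x y = ∃[ as ] IsWalk x as y

  -- dicycle: closed directed walk with at least one arc whose vertices
  -- (not repeating the start at the end) are pairwise distinct
  record Dicycle : Set where
    field
      start  : Fin (V D)
      arc₀   : Fin (A D)
      arcs   : List (Fin (A D))
      closed : IsWalk start (arc₀ ∷ arcs) start
      distinct : Unique (verts (hd D arc₀) arcs)
    cverts : List (Fin (V D))
    cverts = verts (hd D arc₀) arcs

  -- undirected steps in UG(D): an arc together with a traversal direction
  -- (true = forward tail→head, false = backward head→tail)
  Step : Set
  Step = Fin (A D) × Bool

  stepFrom : Step → Fin (V D)
  stepFrom (a , true)  = tl D a
  stepFrom (a , false) = hd D a

  stepTo : Step → Fin (V D)
  stepTo (a , true)  = hd D a
  stepTo (a , false) = tl D a

  stepArc : Step → Fin (A D)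
  stepArc (a , _) = a

  IsUWalk : Fin (V D) → List Step → Fin (V D) → Set
  IsUWalk x []       y = x ≡ y
  IsUWalk x (s ∷ ss) y = stepFrom s ≡ x × IsUWalk (stepTo s) ss y

  uverts : Fin (V D) → List Step → List (Fin (V D))
  uverts x []       = x ∷ []
  uverts x (s ∷ ss) = x ∷ uverts (stepTo s) ss

  arcsOf : List Step → List (Fin (A D))
  arcsOf []       = []
  arcsOf (s ∷ ss) = stepArc s ∷ arcsOf ss

  record Cycle : Set where
    field
      start  : Fin (V D)
      step₀  : Step
      steps  : List Step
      closed : IsUWalk start (step₀ ∷ steps) start
      distinctV : Unique (uverts (stepTo step₀) steps)
      distinctE : Unique (arcsOf (step₀ ∷ steps))
    cverts : List (Fin (V D))
    cverts = uverts (stepTo step₀) steps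

  Adj : Fin (V D) → Fin (V D) → Set
  Adj x y = ∃[ a ] ((tl D a ≡ x × hd D a ≡ y) ⊎ (tl D a ≡ y × hd D a ≡ x))

  IsUniqueNontrivialSC : (Fin (V D) → Bool) → Set
  IsUniqueNontrivialSC S =
      (∃[ x ] ∃[ y ] (x ≢ y × S x ≡ true × S y ≡ true))
    × (∀ x y → S x ≡ true → S y ≡ true → Reach x y × Reach y x)
    × (∀ x y → x ≢ y → Reach x y → Reach y x → S x ≡ true)

  Clasp : (Fin (V D) → Bool) → ℕ → Fin (V D) → Fin (V D) → Fin (V D) → Set
  Clasp S k u v α =
      S α ≡ false × Adj α u × Adj α v
    × Σ Cycle (λ C →
          u ∈ Cycle.cverts C × v ∈ Cycle.cverts C × α ∈ Cycle.cverts C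
        × length (filterᵇ (λ w → not (S w)) (Cycle.cverts C)) ≤ k
        × Σ Dicycle (λ B → ∀ w → w ∈ Cycle.cverts C → ¬ (w ∈ Dicycle.cverts B)))

csuc : ∀ {n} → Fin n → Fin n
csuc {suc n} i = fromℕ< (m%n<n (suc (toℕ i)) (suc n))

-- Vaults.  Wall P_i has vertices (i , 0) = a_i, …, (i , len i) = d_i.

record Vault : Set where
  field
    ℓ      : ℕ
    ℓ≥5    : 5 ≤ ℓ
    ℓ-odd  : ∃[ t ] ℓ ≡ suc (2 * t)
    len    : Fin ℓ → ℕ
    b c    : (i : Fin ℓ) → Fin (suc (len i))
    bc-ok  : ∀ i → (toℕ (c i) ≡ suc (toℕ (b i)))
                   ⊎ (b i ≡ c i × (toℕ (b i) ≡ 0 ⊎ toℕ (b i) ≡ len i))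
    -- rungs from P_i[c_i,d_i] to P_{i+1}[a_{i+1},b_{i+1}] (at least one)
    nR     : Fin ℓ → ℕ
    nR≥1   : ∀ i → 1 ≤ nR i
    rFrom  : (i : Fin ℓ) → Fin (nR i) → Fin (suc (len i))
    rTo    : (i : Fin ℓ) → Fin (nR i) → Fin (suc (len (csuc i)))
    rFrom-ok : ∀ i r → toℕ (c i) ≤ toℕ (rFrom i r)
    rTo-ok   : ∀ i r → toℕ (rTo i r) ≤ toℕ (b (csuc i))
open Vault public

VVert : Vault → Set
VVert W = Σ (Fin (ℓ W)) (λ i → Fin (suc (len W i)))

data VArc (W : Vault) : Set where
  path : (i : Fin (ℓ W)) → Fin (len W i) → VArc W
  rung : (i : Fin (ℓ W)) → Fin (nR W i) → VArc W
  jump : (i : Fin (ℓ W)) → VArc W                   -- arc d_i → a_{i+2}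

vtail : (W : Vault) → VArc W → VVert W
vtail W (path i k) = i , inject₁ k
vtail W (rung i r) = i , rFrom W i r
vtail W (jump i)   = i , fromℕ (len W i)

vhead : (W : Vault) → VArc W → VVert W
vhead W (path i k) = i , fsuc k
vhead W (rung i r) = csuc i , rTo W i r
vhead W (jump i)   = csuc (csuc i) , fzero

HasNiche : Vault → Set
HasNiche W = ∃[ i ] ∃[ r ] ∃[ r' ]
  (toℕ (rFrom W i r) < toℕ (rFrom W i r') × toℕ (rTo W i r') < toℕ (rTo W i r))

dropLast : {X : Set} → List X → List X
dropLast []           = []
dropLast (x ∷ [])     = []
dropLast (x ∷ y ∷ zs) = x ∷ dropLast (y ∷ zs)

inner : {X : Set} → List X → List X
inner []       = []
inner (x ∷ xs) = dropLast xs

record Subdivision (D : Digraph) (S : Fin (V D) → Bool) (W : Vault) : Set where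
  field
    φ      : VVert W → Fin (V D)
    φ-inj  : ∀ x y → φ x ≡ φ y → x ≡ y
    link   : VArc W → List (Fin (A D))
  lverts : VArc W → List (Fin (V D))
  lverts e = verts D (φ (vtail W e)) (link e)
  interior : VArc W → List (Fin (V D))
  interior e = inner (lverts e)
  field
    link-path  : ∀ e → IsDipath D (φ (vtail W e)) (link e) (φ (vhead W e))
    link-S     : ∀ e w → w ∈ lverts e → S w ≡ true
    inner-notφ : ∀ e w x → w ∈ interior e → w ≢ φ x
    inner-disj : ∀ e e' w → w ∈ interior e → w ∈ interior e' → e ≡ e'
    cover-V    : ∀ w → S w ≡ true → (∃[ x ] w ≡ φ x) ⊎ (∃[ e ] w ∈ interior e)
    cover-A    : ∀ a → S (tl D a) ≡ true → S (hd D a) ≡ true → ∃[ e ] a ∈ link e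
    arc-unique : ∀ e e' a → a ∈ link e → a ∈ link e' → e ≡ e'

  -- wall P_i of D': subdivided P_i followed by link of d_i a_{i+2} minus a_{i+2}
  OnWall : Fin (ℓ W) → Fin (V D) → Set
  OnWall i w = (∃[ k ] w ≡ φ (i , k))
             ⊎ (∃[ k ] w ∈ interior (path i k))
             ⊎ w ∈ interior (jump i)

module Submission where

-- Let k ⊕ d be the wall d steps after wall k, indices taken mod ℓ. As ℓ is odd and the
-- walls of u and v are not consecutive, one of the two cyclic distances between them is
-- even, 2m say, with 2m + 2 ≤ ℓ; swapping u and v if needed, u lies on a wall k and v on
-- k ⊕ 2m. The walls k, k ⊕ 2, …, k ⊕ 2m, joined by the arcs d_i a_{i+2}, contain a u–v
-- path of D', which closes through α into a cycle whose only external vertex is α. The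
-- other walls k ⊕ 1, k ⊕ 3, …, k ⊕ (2m + 1), again joined by arcs d_i a_{i+2}, followed by
-- k ⊕ (2m + 2), …, k ⊕ (ℓ − 1) joined by rungs and the arc d_{k−1} a_{k+1}, form a closed
-- directed walk. A dicycle inside it misses the cycle, since no wall and no rung interior
-- is shared.

open import Data.Bool using (Bool; true; false; not)
open import Data.Empty using (⊥; ⊥-elim)
open import Data.Fin using (Fin; toℕ; fromℕ<; fromℕ; inject₁) renaming (zero to fzero)
open import Data.Fin.Properties
  using (_≟_; toℕ-fromℕ<; toℕ-injective; toℕ<n; toℕ-inject₁; toℕ-fromℕ; toℕ≤pred[n])
open import Data.List using (List; []; _∷_; _++_; map; concatMap; length; filterᵇ)
open import Data.List.Membership.Propositional using (_∈_; _∉_)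
open import Data.List.Membership.Propositional.Properties using (∈-++⁺ʳ)
open import Data.List.Properties using (++-conicalˡ; ++-conicalʳ)
open import Data.List.Relation.Binary.Subset.Propositional using (_⊆_)
open import Data.List.Relation.Unary.All using (All; []; _∷_)
open import Data.List.Relation.Unary.All.Properties using (¬Any⇒All¬; All¬⇒¬Any; ++⁺)
open import Data.List.Relation.Unary.AllPairs using ([]; _∷_)
open import Data.List.Relation.Unary.Any using (here; there; any?)
open import Data.List.Relation.Unary.Unique.Propositional using (Unique)
open import Data.Nat
  using (ℕ; zero; suc; _+_; _∸_; _≤_; _<_; z≤n; s≤s; z<s; s<s⁻¹; NonZero; >-nonZero; _<?_)
open import Data.Nat.DivMod using (_%_; %-distribˡ-+; m%n%n≡m%n; [m+n]%n≡m%n; m<n⇒m%n≡m; m%n<n)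
open import Data.Nat.Properties
  using ( even≢odd; +-identityʳ; +-suc; +-assoc; +-comm; m+[n∸m]≡n; m≤m+n; m<m+n; m<n+m
        ; n≤1+n; n<1+n; <⇒≤; ≤∧≢⇒<; ≮⇒≥; <-asym; <-irrefl; ≤-refl; ≤-reflexive; ≤-antisym
        ; ≤-trans; <-trans; ≤-<-trans; <-≤-trans; +-mono-≤; +-monoʳ-≤; +-mono-< )
open import Data.Nat.Tactic.RingSolver using (solve-∀)
open import Data.Product using (Σ-syntax; ∃-syntax; _×_; _,_; proj₁; proj₂)
import Data.Product as Product
open import Data.Sum using (_⊎_; inj₁; inj₂; [_,_])
import Data.Sum as Sum
open import Data.Unit using (⊤; tt)
open import Defs
open import Function using (id; _∘_)
open import Relation.Binary.Definitions using (DecidableEquality)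
open import Relation.Binary.PropositionalEquality
  using (_≡_; _≢_; refl; sym; trans; cong; subst; module ≡-Reasoning)
open import Relation.Nullary using (¬_; yes; no)

-- Cyclic arithmetic on wall indices

odd≢even : ∀ a b → suc (a + a) ≢ b + b
odd≢even a b eq = even≢odd b a (begin
    b + (b + 0)         ≡⟨ cong (b +_) (+-identityʳ b) ⟩
    b + b               ≡⟨ sym eq ⟩
    suc (a + a)         ≡⟨ cong (λ z → suc (a + z)) (sym (+-identityʳ a)) ⟩
    suc (a + (a + 0))   ∎)
  where open ≡-Reasoning

parity : ∀ d → ∃[ s ] (d ≡ s + s ⊎ d ≡ suc (s + s))
parity zero = 0 , inj₁ refl
parity (suc d) with parity d
... | s , inj₁ refl = s , inj₂ refl
... | s , inj₂ refl = suc s , inj₁ (cong suc (sym (+-suc s s)))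

+-∸-cancel : ∀ {a n} x → a ≤ n → a + (x + (n ∸ a)) ≡ x + n
+-∸-cancel {a} {n} x a≤n = begin
    a + (x + (n ∸ a))   ≡⟨ sym (+-assoc a x _) ⟩
    a + x + (n ∸ a)     ≡⟨ cong (_+ (n ∸ a)) (+-comm a x) ⟩
    x + a + (n ∸ a)     ≡⟨ +-assoc x a _ ⟩
    x + (a + (n ∸ a))   ≡⟨ cong (x +_) (m+[n∸m]≡n a≤n) ⟩
    x + n               ∎
  where open ≡-Reasoning

toℕ-csuc : ∀ {n} .{{_ : NonZero n}} (i : Fin n) → toℕ (csuc i) ≡ suc (toℕ i) % n
toℕ-csuc {suc n} i = toℕ-fromℕ< _

module CyclicShift (L : ℕ) {{_ : NonZero L}} where

  infixl 6 _⊕_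
  _⊕_ : Fin L → ℕ → Fin L
  k ⊕ zero  = k
  k ⊕ suc n = csuc k ⊕ n

  %-absorbˡ : ∀ a b → (a % L + b) % L ≡ (a + b) % L
  %-absorbˡ a b = begin
      (a % L + b) % L           ≡⟨ %-distribˡ-+ (a % L) b L ⟩
      (a % L % L + b % L) % L   ≡⟨ cong (λ z → (z + b % L) % L) (m%n%n≡m%n a L) ⟩
      (a % L + b % L) % L       ≡⟨ sym (%-distribˡ-+ a b L) ⟩
      (a + b) % L               ∎
    where open ≡-Reasoning

  %-absorbʳ : ∀ a b → (a + b % L) % L ≡ (a + b) % L
  %-absorbʳ a b = begin
      (a + b % L) % L   ≡⟨ cong (_% L) (+-comm a (b % L)) ⟩
      (b % L + a) % L   ≡⟨ %-absorbˡ b a ⟩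
      (b + a) % L       ≡⟨ cong (_% L) (+-comm b a) ⟩
      (a + b) % L       ∎
    where open ≡-Reasoning

  toℕ-⊕ : ∀ k n → toℕ (k ⊕ n) ≡ (toℕ k + n) % L
  toℕ-⊕ k zero = sym (trans (cong (_% L) (+-identityʳ (toℕ k))) (m<n⇒m%n≡m (toℕ<n k)))
  toℕ-⊕ k (suc n) = begin
      toℕ (csuc k ⊕ n)            ≡⟨ toℕ-⊕ (csuc k) n ⟩
      (toℕ (csuc k) + n) % L      ≡⟨ cong (λ z → (z + n) % L) (toℕ-csuc k) ⟩
      (suc (toℕ k) % L + n) % L   ≡⟨ %-absorbˡ (suc (toℕ k)) n ⟩
      (suc (toℕ k) + n) % L       ≡⟨ cong (_% L) (sym (+-suc (toℕ k) n)) ⟩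
      (toℕ k + suc n) % L         ∎
    where open ≡-Reasoning

  ⊕-+ : ∀ k a b → k ⊕ (a + b) ≡ k ⊕ a ⊕ b
  ⊕-+ k zero    b = refl
  ⊕-+ k (suc a) b = ⊕-+ (csuc k) a b

  ⊕-suc : ∀ k n → csuc (k ⊕ n) ≡ k ⊕ suc n
  ⊕-suc k zero    = refl
  ⊕-suc k (suc n) = ⊕-suc (csuc k) n

  ⊕-double : ∀ k m → k ⊕ 2 ⊕ (m + m) ≡ k ⊕ (suc m + suc m)
  ⊕-double k m = begin
      k ⊕ 2 ⊕ (m + m)       ≡⟨ sym (⊕-+ k 2 (m + m)) ⟩
      k ⊕ (2 + (m + m))     ≡⟨ cong (λ z → k ⊕ suc z) (sym (+-suc m m)) ⟩
      k ⊕ (suc m + suc m)   ∎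
    where open ≡-Reasoning

  ⊕-period : ∀ k → k ⊕ L ≡ k
  ⊕-period k = toℕ-injective (begin
      toℕ (k ⊕ L)       ≡⟨ toℕ-⊕ k L ⟩
      (toℕ k + L) % L   ≡⟨ [m+n]%n≡m%n (toℕ k) L ⟩
      toℕ k % L         ≡⟨ m<n⇒m%n≡m (toℕ<n k) ⟩
      toℕ k             ∎)
    where open ≡-Reasoning

  ⊕-unshift : ∀ k {x} → x < L → (toℕ (k ⊕ x) + (L ∸ toℕ k)) % L ≡ x
  ⊕-unshift k {x} x<L = begin
      (toℕ (k ⊕ x) + (L ∸ toℕ k)) % L         ≡⟨ cong (λ z → (z + (L ∸ toℕ k)) % L) (toℕ-⊕ k x) ⟩
      ((toℕ k + x) % L + (L ∸ toℕ k)) % L     ≡⟨ %-absorbˡ (toℕ k + x) (L ∸ toℕ k) ⟩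
      (toℕ k + x + (L ∸ toℕ k)) % L           ≡⟨ cong (_% L) (+-assoc (toℕ k) x _) ⟩
      (toℕ k + (x + (L ∸ toℕ k))) % L         ≡⟨ cong (_% L) (+-∸-cancel x (<⇒≤ (toℕ<n k))) ⟩
      (x + L) % L                             ≡⟨ [m+n]%n≡m%n x L ⟩
      x % L                                   ≡⟨ m<n⇒m%n≡m x<L ⟩
      x                                       ∎
    where open ≡-Reasoning

  ⊕-injective : ∀ k {x y} → x < L → y < L → k ⊕ x ≡ k ⊕ y → x ≡ y
  ⊕-injective k {x} {y} x<L y<L eq = begin
      x                                   ≡⟨ sym (⊕-unshift k x<L) ⟩
      (toℕ (k ⊕ x) + (L ∸ toℕ k)) % L     ≡⟨ cong (λ z → (toℕ z + (L ∸ toℕ k)) % L) eq ⟩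
      (toℕ (k ⊕ y) + (L ∸ toℕ k)) % L     ≡⟨ ⊕-unshift k y<L ⟩
      y                                   ∎
    where open ≡-Reasoning

  ⊕-offset : ∀ i j → ∃[ d ] (d < L × i ⊕ d ≡ j)
  ⊕-offset i j = d , m%n<n _ L , toℕ-injective (begin
      toℕ (i ⊕ d)                              ≡⟨ toℕ-⊕ i d ⟩
      (toℕ i + d) % L                          ≡⟨ %-absorbʳ (toℕ i) (toℕ j + (L ∸ toℕ i)) ⟩
      (toℕ i + (toℕ j + (L ∸ toℕ i))) % L      ≡⟨ cong (_% L) (+-∸-cancel (toℕ j) (<⇒≤ (toℕ<n i))) ⟩
      (toℕ j + L) % L                          ≡⟨ [m+n]%n≡m%n (toℕ j) L ⟩
      toℕ j % L                                ≡⟨ m<n⇒m%n≡m (toℕ<n j) ⟩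
      toℕ j                                    ∎)
    where
    open ≡-Reasoning
    d : ℕ
    d = (toℕ j + (L ∸ toℕ i)) % L

  EvenGap : Fin L → Fin L → Set
  EvenGap i j = ∃[ m ] (suc (m + m) < L × j ≡ i ⊕ (m + m))

  -- For odd L, one of the two cyclic offsets between i and j is even; it is not L ∸ 1
  -- (resp. 1) because j is not the successor of i nor i the successor of j.
  evenGap : (∃[ t ] L ≡ suc (t + t)) → ∀ i j → j ≢ csuc i → i ≢ csuc j → EvenGap i j ⊎ EvenGap j i
  evenGap (t , L-odd) i j j≢i+1 i≢j+1 with ⊕-offset i j
  ... | d , d<L , i⊕d≡j with parity d
  ...   | s , inj₁ refl = inj₁ (s , ≤∧≢⇒< d<L d+1≢L , sym i⊕d≡j)
    where
    d+1≢L : suc (s + s) ≢ L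
    d+1≢L eq = i≢j+1 (begin
        i                   ≡⟨ sym (⊕-period i) ⟩
        i ⊕ L               ≡⟨ cong (i ⊕_) (sym eq) ⟩
        i ⊕ suc (s + s)     ≡⟨ sym (⊕-suc i (s + s)) ⟩
        csuc (i ⊕ (s + s))  ≡⟨ cong csuc i⊕d≡j ⟩
        csuc j              ∎)
      where open ≡-Reasoning
  ...   | zero , inj₂ refl = ⊥-elim (j≢i+1 (sym i⊕d≡j))
  ...   | suc s₀ , inj₂ refl = inj₂ (r , r+r+1<L , i≡j⊕2r)
    where
    s : ℕ
    s = suc s₀
    s≤t : s ≤ t
    s≤t = ≮⇒≥ λ t<s → <-asym (s<s⁻¹ (subst (suc (s + s) <_) L-odd d<L)) (+-mono-< t<s t<s)
    r : ℕ
    r = t ∸ s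
    t≡s+r : t ≡ s + r
    t≡s+r = sym (m+[n∸m]≡n s≤t)
    r+r+1<L : suc (r + r) < L
    r+r+1<L = subst (suc (r + r) <_) (sym L-odd)
                (s≤s (+-mono-< r<t r<t))
      where r<t : r < t
            r<t = subst (r <_) (sym t≡s+r) (m<n+m r z<s)
    i≡j⊕2r : i ≡ j ⊕ (r + r)
    i≡j⊕2r = begin
        i                               ≡⟨ sym (⊕-period i) ⟩
        i ⊕ L                           ≡⟨ cong (i ⊕_) (trans L-odd (cong (λ z → suc (z + z)) t≡s+r)) ⟩
        i ⊕ suc ((s + r) + (s + r))     ≡⟨ cong (i ⊕_) (sym (rearrange s r)) ⟩
        i ⊕ (suc (s + s) + (r + r))     ≡⟨ ⊕-+ i (suc (s + s)) (r + r) ⟩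
        i ⊕ suc (s + s) ⊕ (r + r)       ≡⟨ cong (_⊕ (r + r)) i⊕d≡j ⟩
        j ⊕ (r + r)                     ∎
      where
      open ≡-Reasoning
      rearrange : ∀ s r → suc (s + s) + (r + r) ≡ suc ((s + r) + (s + r))
      rearrange = solve-∀

dropLast⊆ : ∀ {X : Set} (xs : List X) → dropLast xs ⊆ xs
dropLast⊆ (x ∷ y ∷ zs) (here p)  = here p
dropLast⊆ (x ∷ y ∷ zs) (there p) = there (dropLast⊆ (y ∷ zs) p)

inner⊆ : ∀ {X : Set} (xs : List X) → inner xs ⊆ xs
inner⊆ (x ∷ xs) = there ∘ dropLast⊆ xs

module Walks {X St : Set} (src tgt : St → X) where

  Walk : X → List St → X → Set
  Walk x []       y = x ≡ y
  Walk x (s ∷ ss) y = src s ≡ x × Walk (tgt s) ss y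

  vertices : X → List St → List X
  vertices x []       = x ∷ []
  vertices x (s ∷ ss) = x ∷ vertices (tgt s) ss

  first∈vertices : ∀ x ss → x ∈ vertices x ss
  first∈vertices x []      = here refl
  first∈vertices x (_ ∷ _) = here refl

  last∈vertices : ∀ {x ss y} → Walk x ss y → y ∈ vertices x ss
  last∈vertices {ss = []}    refl    = here refl
  last∈vertices {ss = _ ∷ _} (_ , w) = there (last∈vertices w)

  walk-++ : ∀ {x ss y ts z} → Walk x ss y → Walk y ts z → Walk x (ss ++ ts) z
  walk-++ {ss = []}    refl    w′ = w′
  walk-++ {ss = _ ∷ _} (e , w) w′ = e , walk-++ w w′

  ∈-vertices-++⁻ : ∀ {x ss y} ts → Walk x ss y →
                   ∀ {w} → w ∈ vertices x (ss ++ ts) → w ∈ vertices x ss ⊎ w ∈ vertices y ts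
  ∈-vertices-++⁻ {ss = []}    ts refl    p         = inj₂ p
  ∈-vertices-++⁻ {ss = _ ∷ _} ts (_ , w) (here p)  = inj₁ (here p)
  ∈-vertices-++⁻ {ss = _ ∷ _} ts (_ , w) (there p) = Sum.map₁ there (∈-vertices-++⁻ ts w p)

  ∈-vertices⇒last⊎init : ∀ {x ss y w} → Walk x ss y → w ∈ vertices x ss →
                         w ≡ y ⊎ w ∈ dropLast (vertices x ss)
  ∈-vertices⇒last⊎init {ss = []}         refl       (here refl)         = inj₁ refl
  ∈-vertices⇒last⊎init {ss = _ ∷ []}     (_ , refl) (here refl)         = inj₂ (here refl)
  ∈-vertices⇒last⊎init {ss = _ ∷ []}     (_ , refl) (there (here refl)) = inj₁ refl
  ∈-vertices⇒last⊎init {ss = _ ∷ _ ∷ _}  (_ , w)    (here refl)         = inj₂ (here refl)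
  ∈-vertices⇒last⊎init {ss = _ ∷ _ ∷ _}  (_ , w)    (there p)           =
    Sum.map₂ there (∈-vertices⇒last⊎init w p)

  ∈-vertices⇒ends⊎inner : ∀ {x ss y w} → Walk x ss y → w ∈ vertices x ss →
                          w ≡ x ⊎ w ≡ y ⊎ w ∈ inner (vertices x ss)
  ∈-vertices⇒ends⊎inner {ss = []}    refl    (here refl) = inj₁ refl
  ∈-vertices⇒ends⊎inner {ss = _ ∷ _} _       (here refl) = inj₁ refl
  ∈-vertices⇒ends⊎inner {ss = _ ∷ _} (_ , w) (there p)   = inj₂ (∈-vertices⇒last⊎init w p)

  record WalkWithin (P : X → Set) (x y : X) : Set where
    constructor walkWithin
    field
      steps  : List St
      walk   : Walk x steps y
      within : ∀ {w} → w ∈ vertices x steps → P w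

  module _ {P : X → Set} where

    infixr 5 _++ʷ_
    _++ʷ_ : ∀ {x y z} → WalkWithin P x y → WalkWithin P y z → WalkWithin P x z
    walkWithin ss w p ++ʷ walkWithin ts w′ p′ =
      walkWithin (ss ++ ts) (walk-++ w w′) λ q → [ p , p′ ] (∈-vertices-++⁻ ts w q)

    mapWithin : ∀ {Q : X → Set} {x y} → (∀ {w} → P w → Q w) → WalkWithin P x y → WalkWithin Q x y
    mapWithin f (walkWithin ss w p) = walkWithin ss w (f ∘ p)

  prefixInit : ∀ {x ss y w} → Walk x ss y → w ∈ dropLast (vertices x ss) →
               WalkWithin (_∈ dropLast (vertices x ss)) x w
  prefixInit {ss = []}        _       ()
  prefixInit {ss = _ ∷ []}    _       (here refl) = walkWithin [] refl λ { (here refl) → here refl }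
  prefixInit {ss = _ ∷ []}    _       (there ())
  prefixInit {ss = _ ∷ _ ∷ _} _       (here refl) = walkWithin [] refl λ { (here refl) → here refl }
  prefixInit {ss = s ∷ _ ∷ _} (e , w) (there p)   =
    let walkWithin ts w′ q = prefixInit w p
    in walkWithin (s ∷ ts) (e , w′) λ { (here refl) → here refl ; (there r) → there (q r) }

  prefixInner : ∀ {x ss y w} → Walk x ss y → w ∈ inner (vertices x ss) →
                WalkWithin (λ q → q ≡ x ⊎ q ∈ inner (vertices x ss)) x w
  prefixInner {ss = []}    _       ()
  prefixInner {ss = s ∷ _} (e , w) p =
    let walkWithin ts w′ q = prefixInit w p
    in walkWithin (s ∷ ts) (e , w′) λ { (here refl) → inj₁ refl ; (there r) → inj₂ (q r) }

  module _ (_≟_ : DecidableEquality X) where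

    suffix : ∀ {x ss y z} → Walk x ss y → Unique (vertices x ss) → z ∈ vertices x ss →
             Σ[ ts ∈ List St ] (Walk z ts y × Unique (vertices z ts) × vertices z ts ⊆ vertices x ss)
    suffix {ss = []}    w       u       (here refl) = [] , w , u , id
    suffix {ss = _ ∷ _} w       u       (here refl) = _ , w , u , id
    suffix {ss = _ ∷ _} (_ , w) (_ ∷ u) (there p)   =
      let ts , w′ , u′ , ts⊆ = suffix w u p in ts , w′ , u′ , there ∘ ts⊆

    shortcut : ∀ {x ss y} → Walk x ss y →
               Σ[ ts ∈ List St ] (Walk x ts y × Unique (vertices x ts) × vertices x ts ⊆ vertices x ss)
    shortcut {ss = []} w = [] , w , [] ∷ [] , id
    shortcut {x} {s ∷ ss} (e , w) with shortcut w
    ... | ts , w′ , u′ , ts⊆ with any? (x ≟_) (vertices (tgt s) ts)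
    ...   | yes x∈ = let rs , w″ , u″ , rs⊆ = suffix w′ u′ x∈ in rs , w″ , u″ , there ∘ ts⊆ ∘ rs⊆
    ...   | no  x∉ = s ∷ ts , (e , w′) , ¬Any⇒All¬ _ x∉ ∷ u′
                   , λ { (here p) → here p ; (there q) → there (ts⊆ q) }

-- Walks, cycles and dicycles of a digraph

module DiWalks (D : Digraph) = Walks (tl D) (hd D)
module UWalks  (D : Digraph) = Walks (stepFrom D) (stepTo D)

module _ (D : Digraph) where
  private
    module Dir = DiWalks D
    module Und = UWalks D

  isWalk⇒walk : ∀ {x as y} → IsWalk D x as y → Dir.Walk x as y
  isWalk⇒walk {as = []}    w       = w
  isWalk⇒walk {as = _ ∷ _} (e , w) = e , isWalk⇒walk w

  walk⇒isWalk : ∀ {x as y} → Dir.Walk x as y → IsWalk D x as y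
  walk⇒isWalk {as = []}    w       = w
  walk⇒isWalk {as = _ ∷ _} (e , w) = e , walk⇒isWalk w

  verts≡vertices : ∀ x as → verts D x as ≡ Dir.vertices x as
  verts≡vertices x []       = refl
  verts≡vertices x (a ∷ as) = cong (x ∷_) (verts≡vertices (hd D a) as)

  walk⇒isUWalk : ∀ {x ss y} → Und.Walk x ss y → IsUWalk D x ss y
  walk⇒isUWalk {ss = []}    w       = w
  walk⇒isUWalk {ss = _ ∷ _} (e , w) = e , walk⇒isUWalk w

  uverts≡vertices : ∀ x ss → uverts D x ss ≡ Und.vertices x ss
  uverts≡vertices x []       = refl
  uverts≡vertices x (s ∷ ss) = cong (x ∷_) (uverts≡vertices (stepTo D s) ss)

  dicycle-in-closedWalk : ∀ {x as} → Dir.Walk x as x → as ≢ [] →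
                          Σ[ B ∈ Dicycle D ] Dicycle.cverts B ⊆ Dir.vertices x as
  dicycle-in-closedWalk {as = []} _ as≢[] = ⊥-elim (as≢[] refl)
  dicycle-in-closedWalk {x} {a ∷ as} (e , w) _ =
    let ps , w′ , u′ , ps⊆ = Dir.shortcut _≟_ w
    in record { start = x ; arc₀ = a ; arcs = ps ; closed = e , walk⇒isWalk w′
              ; distinct = subst Unique (sym (verts≡vertices _ ps)) u′ }
       , there ∘ ps⊆ ∘ subst (_ ∈_) (verts≡vertices _ ps)

  forwardSteps : List (Fin (A D)) → List (Step D)
  forwardSteps = map (_, true)

  forwardWalk : ∀ {x as y} → Dir.Walk x as y → Und.Walk x (forwardSteps as) y
  forwardWalk {as = []}    w       = w
  forwardWalk {as = _ ∷ _} (e , w) = e , forwardWalk w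

  vertices-forwardSteps : ∀ x as → Und.vertices x (forwardSteps as) ≡ Dir.vertices x as
  vertices-forwardSteps x []       = refl
  vertices-forwardSteps x (a ∷ as) = cong (x ∷_) (vertices-forwardSteps (hd D a) as)

  forward : ∀ {P x y} → Dir.WalkWithin P x y → Und.WalkWithin P x y
  forward (Dir.walkWithin as w p) =
    Und.walkWithin (forwardSteps as) (forwardWalk w) (p ∘ subst (_ ∈_) (vertices-forwardSteps _ as))

  backwardSteps : List (Fin (A D)) → List (Step D)
  backwardSteps []       = []
  backwardSteps (a ∷ as) = backwardSteps as ++ (a , false) ∷ []

  backwardWalk : ∀ {x as y} → Dir.Walk x as y → Und.Walk y (backwardSteps as) x
  backwardWalk {as = []}    refl     = refl
  backwardWalk {as = _ ∷ _} (refl , w) = Und.walk-++ (backwardWalk w) (refl , refl)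

  vertices-backwardSteps : ∀ {x as y} → Dir.Walk x as y →
                           Und.vertices y (backwardSteps as) ⊆ Dir.vertices x as
  vertices-backwardSteps {as = []}     refl       (here refl) = here refl
  vertices-backwardSteps {as = a ∷ as} (refl , w) q
    with Und.∈-vertices-++⁻ ((a , false) ∷ []) (backwardWalk w) q
  ... | inj₁ q′                = there (vertices-backwardSteps w q′)
  ... | inj₂ (here refl)        = there (Dir.first∈vertices (hd D a) as)
  ... | inj₂ (there (here refl)) = here refl

  backward : ∀ {P x y} → Dir.WalkWithin P x y → Und.WalkWithin P y x
  backward (Dir.walkWithin as w p) =
    Und.walkWithin (backwardSteps as) (backwardWalk w) (p ∘ vertices-backwardSteps w)

  arc-ends-on-walk : ∀ {x ss y a} → Und.Walk x ss y → a ∈ arcsOf D ss →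
                     tl D a ∈ Und.vertices x ss × hd D a ∈ Und.vertices x ss
  arc-ends-on-walk {ss = (_ , true)  ∷ ss} (refl , _) (here refl) =
    here refl , there (Und.first∈vertices _ ss)
  arc-ends-on-walk {ss = (_ , false) ∷ ss} (refl , _) (here refl) =
    there (Und.first∈vertices _ ss) , here refl
  arc-ends-on-walk {ss = _ ∷ _}            (_ , w)    (there p)   =
    Product.map there there (arc-ends-on-walk w p)

  step-ends-on-walk : ∀ {x ss y} (s : Step D) → Und.Walk x ss y → stepArc D s ∈ arcsOf D ss →
                      stepFrom D s ∈ Und.vertices x ss × stepTo D s ∈ Und.vertices x ss
  step-ends-on-walk (_ , true)  w p = arc-ends-on-walk w p
  step-ends-on-walk (_ , false) w p = Product.swap (arc-ends-on-walk w p)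

  arcsOf-unique : ∀ {x ss y} → Und.Walk x ss y → Unique (Und.vertices x ss) → Unique (arcsOf D ss)
  arcsOf-unique {ss = []}    _        _          = []
  arcsOf-unique {ss = s ∷ _} (refl , w) (x∉ ∷ u) =
    ¬Any⇒All¬ _ (λ s∈ → All¬⇒¬Any x∉ (proj₁ (step-ends-on-walk s w s∈))) ∷ arcsOf-unique w u

  same-arc : ∀ (s t : Step D) → stepArc D s ≡ stepArc D t →
             (stepFrom D s ≡ stepFrom D t × stepTo D s ≡ stepTo D t)
             ⊎ (stepFrom D s ≡ stepTo D t × stepTo D s ≡ stepFrom D t)
  same-arc (_ , true)  (_ , true)  refl = inj₁ (refl , refl)
  same-arc (_ , true)  (_ , false) refl = inj₂ (refl , refl)
  same-arc (_ , false) (_ , true)  refl = inj₂ (refl , refl)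
  same-arc (_ , false) (_ , false) refl = inj₁ (refl , refl)

  step-towards : ∀ {α x} → Adj D α x → Σ[ s ∈ Step D ] (stepFrom D s ≡ α × stepTo D s ≡ x)
  step-towards (a , inj₁ (t , h)) = (a , true)  , t , h
  step-towards (a , inj₂ (t , h)) = (a , false) , h , t

  step-from : ∀ {α y} → Adj D α y → Σ[ s ∈ Step D ] (stepFrom D s ≡ y × stepTo D s ≡ α)
  step-from (a , inj₁ (t , h)) = (a , false) , h , t
  step-from (a , inj₂ (t , h)) = (a , true)  , t , h

  module _ (S : Fin (V D) → Bool) where

    no-externals : ∀ xs → (∀ {w} → w ∈ xs → S w ≡ true) →
                   length (filterᵇ (λ w → not (S w)) xs) ≡ 0
    no-externals []       _        = refl
    no-externals (x ∷ xs) internal rewrite internal (here refl) = no-externals xs (internal ∘ there)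

    at-most-one-external : ∀ α xs → (∀ {w} → w ∈ xs → S w ≡ true) →
                           length (filterᵇ (λ w → not (S w)) (α ∷ xs)) ≤ 1
    at-most-one-external α xs internal with S α
    ... | true  = ≤-trans (≤-reflexive (no-externals xs internal)) z≤n
    ... | false = s≤s (≤-reflexive (no-externals xs internal))

    cycle-through-external : ∀ {ps} (fw bk : Step D) → stepFrom D fw ≡ stepTo D bk →
      S (stepTo D bk) ≡ false → stepTo D fw ≢ stepFrom D bk →
      Und.Walk (stepTo D fw) ps (stepFrom D bk) → Unique (Und.vertices (stepTo D fw) ps) →
      (∀ {w} → w ∈ Und.vertices (stepTo D fw) ps → S w ≡ true) →
      Σ[ C ∈ Cycle D ] Cycle.cverts C ≡ stepTo D bk ∷ Und.vertices (stepTo D fw) ps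
    cycle-through-external {ps} fw bk fw-from Sα x≢y w u internal =
      record { start = stepFrom D bk ; step₀ = bk ; steps = fw ∷ ps
             ; closed = refl , fw-from , walk⇒isUWalk w
             ; distinctV = subst (λ vs → Unique (stepTo D bk ∷ vs)) (sym (uverts≡vertices _ ps))
                                 (¬Any⇒All¬ _ α∉path ∷ u)
             ; distinctE = (bk≢fw ∷ ¬Any⇒All¬ _ (α∉path ∘ proj₂ ∘ step-ends-on-walk bk w))
                           ∷ ¬Any⇒All¬ _ (α∉path ∘ subst (_∈ _) fw-from
                                               ∘ proj₁ ∘ step-ends-on-walk fw w)
                           ∷ arcsOf-unique w u }
      , cong (stepTo D bk ∷_) (uverts≡vertices _ ps)
      where
      α∉path : stepTo D bk ∉ Und.vertices (stepTo D fw) ps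
      α∉path α∈ with trans (sym (internal α∈)) Sα
      ... | ()
      bk≢fw : stepArc D bk ≢ stepArc D fw
      bk≢fw same with same-arc bk fw same
      ... | inj₁ (y≡α , _) = α∉path (subst (_∈ _) (trans y≡α fw-from) (Und.last∈vertices w))
      ... | inj₂ (y≡x , _) = x≢y (sym y≡x)

    clasp-from-walk : ∀ {α x y} → S α ≡ false → x ≢ y → Adj D α x → Adj D α y →
      (B : Dicycle D) → α ∉ Dicycle.cverts B →
      Und.WalkWithin (λ w → S w ≡ true × w ∉ Dicycle.cverts B) x y →
      Clasp D S 1 x y α
    clasp-from-walk Sα x≢y αx αy B α∉B (Und.walkWithin ss w inside)
      with step-towards αx | step-from αy | Und.shortcut _≟_ w
    ... | fw , fw-from , refl | bk , refl , refl | ps , pw , pu , ps⊆ =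
      Sα , αx , αy , C
      , on-C (there (Und.first∈vertices _ ps)) , on-C (there (Und.last∈vertices pw)) , on-C (here refl)
      , one-external , B , disjoint
      where
      path-inside : ∀ {v} → v ∈ Und.vertices (stepTo D fw) ps → S v ≡ true × v ∉ Dicycle.cverts B
      path-inside q = inside (ps⊆ q)
      C-with-verts : Σ[ C ∈ Cycle D ] Cycle.cverts C ≡ stepTo D bk ∷ Und.vertices (stepTo D fw) ps
      C-with-verts = cycle-through-external fw bk fw-from Sα x≢y pw pu (λ q → proj₁ (path-inside q))
      C : Cycle D
      C = proj₁ C-with-verts
      on-C : ∀ {v} → v ∈ stepTo D bk ∷ Und.vertices (stepTo D fw) ps → v ∈ Cycle.cverts C
      on-C {v} = subst (v ∈_) (sym (proj₂ C-with-verts))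
      one-external : length (filterᵇ (λ w → not (S w)) (Cycle.cverts C)) ≤ 1
      one-external = subst (λ vs → length (filterᵇ (λ w → not (S w)) vs) ≤ 1)
                           (sym (proj₂ C-with-verts))
                           (at-most-one-external _ _ (λ q → proj₁ (path-inside q)))
      disjoint : ∀ v → v ∈ Cycle.cverts C → v ∉ Dicycle.cverts B
      disjoint v v∈C with subst (v ∈_) (proj₂ C-with-verts) v∈C
      ... | here refl = α∉B
      ... | there v∈  = proj₂ (path-inside v∈)

  clasp-sym : ∀ {S k u v α} → Clasp D S k u v α → Clasp D S k v u α
  clasp-sym (Sα , αu , αv , C , u∈ , v∈ , α∈ , rest) = Sα , αv , αu , C , v∈ , u∈ , α∈ , rest

-- Walls of a subdivided vault

module OnVault (D : Digraph) (S : Fin (V D) → Bool) (W : Vault) (σ : Subdivision D S W) where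
  open Subdivision σ
  private
    module Dir = DiWalks D
    module Und = UWalks D
    module VaultWalks = Walks (vtail W) (vhead W)

  instance
    ℓ-nonZero : NonZero (ℓ W)
    ℓ-nonZero = >-nonZero (≤-trans z<s (ℓ≥5 W))

  open CyclicShift (ℓ W)

  ℓ≡suc[t+t] : ∃[ t ] ℓ W ≡ suc (t + t)
  ℓ≡suc[t+t] = let t , ℓ≡ = ℓ-odd W in t , trans ℓ≡ (cong (λ z → suc (t + z)) (+-identityʳ t))

  link-walk : ∀ e → Dir.Walk (φ (vtail W e)) (link e) (φ (vhead W e))
  link-walk e = isWalk⇒walk D (proj₁ (link-path e))

  lverts≡vertices : ∀ e → lverts e ≡ Dir.vertices (φ (vtail W e)) (link e)
  lverts≡vertices e = verts≡vertices D _ (link e)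

  on-link⇒ends⊎interior : ∀ e {w} → w ∈ lverts e →
                          w ≡ φ (vtail W e) ⊎ w ≡ φ (vhead W e) ⊎ w ∈ interior e
  on-link⇒ends⊎interior e {w} w∈ =
    Sum.map₂ (Sum.map₂ (subst (λ vs → w ∈ inner vs) (sym (lverts≡vertices e))))
      (Dir.∈-vertices⇒ends⊎inner (link-walk e) (subst (w ∈_) (lverts≡vertices e) w∈))

  arc-from : (x : VVert W) → Σ[ e ∈ VArc W ] vtail W e ≡ x
  arc-from (k , p) with toℕ p <? len W k
  ... | yes p<len = path k (fromℕ< p<len) ,
        cong (k ,_) (toℕ-injective (trans (toℕ-inject₁ _) (toℕ-fromℕ< p<len)))
  ... | no  p≮len = jump k , cong (k ,_) (toℕ-injective (trans (toℕ-fromℕ (len W k))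
        (sym (≤-antisym (toℕ≤pred[n] p) (≮⇒≥ p≮len)))))

  φ-S : ∀ x → S (φ x) ≡ true
  φ-S x with arc-from x
  ... | e , refl = link-S e _ (subst (φ (vtail W e) ∈_) (sym (lverts≡vertices e))
                                     (Dir.first∈vertices _ (link e)))

  OnWall-S : ∀ {k w} → OnWall k w → S w ≡ true
  OnWall-S     (inj₁ (p , refl))      = φ-S _
  OnWall-S {k} (inj₂ (inj₁ (t , w∈))) = link-S (path k t) _ (inner⊆ _ w∈)
  OnWall-S {k} (inj₂ (inj₂ w∈))       = link-S (jump k) _ (inner⊆ _ w∈)

  OnWall-unique : ∀ {k k′ w} → OnWall k w → OnWall k′ w → k ≡ k′
  OnWall-unique (inj₁ (p , refl)) (inj₁ (p′ , φ≡)) = cong proj₁ (φ-inj _ _ φ≡)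
  OnWall-unique (inj₁ (p , refl)) (inj₂ (inj₁ (_ , w∈))) = ⊥-elim (inner-notφ _ _ _ w∈ refl)
  OnWall-unique (inj₁ (p , refl)) (inj₂ (inj₂ w∈))       = ⊥-elim (inner-notφ _ _ _ w∈ refl)
  OnWall-unique (inj₂ (inj₁ (_ , w∈))) (inj₁ (p , refl)) = ⊥-elim (inner-notφ _ _ _ w∈ refl)
  OnWall-unique (inj₂ (inj₂ w∈))       (inj₁ (p , refl)) = ⊥-elim (inner-notφ _ _ _ w∈ refl)
  OnWall-unique (inj₂ (inj₁ (t , w∈))) (inj₂ (inj₁ (t′ , w∈′))) with inner-disj _ _ _ w∈ w∈′
  ... | refl = refl
  OnWall-unique (inj₂ (inj₁ (t , w∈))) (inj₂ (inj₂ w∈′)) with inner-disj _ _ _ w∈ w∈′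
  ... | ()
  OnWall-unique (inj₂ (inj₂ w∈)) (inj₂ (inj₁ (t′ , w∈′))) with inner-disj _ _ _ w∈ w∈′
  ... | ()
  OnWall-unique (inj₂ (inj₂ w∈)) (inj₂ (inj₂ w∈′)) with inner-disj _ _ _ w∈ w∈′
  ... | refl = refl

  rung-interior-off-walls : ∀ {k r k′ w} → w ∈ interior (rung k r) → ¬ OnWall k′ w
  rung-interior-off-walls w∈ (inj₁ (p , refl)) = inner-notφ _ _ _ w∈ refl
  rung-interior-off-walls w∈ (inj₂ (inj₁ (t , w∈′))) with inner-disj _ _ _ w∈ w∈′
  ... | ()
  rung-interior-off-walls w∈ (inj₂ (inj₂ w∈′)) with inner-disj _ _ _ w∈ w∈′
  ... | ()

  -- R decides whether rungs are admitted.
  ArcWithin : (Fin (ℓ W) → Set) → Set → VArc W → Set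
  ArcWithin P R (path k _) = P k
  ArcWithin P R (rung k _) = R × P k × P (csuc k)
  ArcWithin P R (jump k)   = P k × P (csuc (csuc k))

  InWalls : (Fin (ℓ W) → Set) → Set → Fin (V D) → Set
  InWalls P R w = (∃[ k ] (P k × OnWall k w)) ⊎ (R × ∃[ k ] ∃[ r ] w ∈ interior (rung k r))

  InWalls-S : ∀ {P R w} → InWalls P R w → S w ≡ true
  InWalls-S (inj₁ (_ , _ , on-k))     = OnWall-S on-k
  InWalls-S (inj₂ (_ , k , r , w∈))  = link-S (rung k r) _ (inner⊆ _ w∈)

  InWalls-disjoint : ∀ {P R w} → InWalls P ⊥ w → ¬ InWalls (λ k → ¬ P k) R w
  InWalls-disjoint (inj₁ (k , Pk , on-k)) (inj₁ (k′ , ¬Pk′ , on-k′)) =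
    ¬Pk′ (subst _ (OnWall-unique on-k on-k′) Pk)
  InWalls-disjoint (inj₁ (k , Pk , on-k)) (inj₂ (_ , _ , _ , w∈))    = rung-interior-off-walls w∈ on-k
  InWalls-disjoint (inj₂ (() , _))

  ArcWithin-head : ∀ {P R} e → ArcWithin P R e → P (proj₁ (vhead W e))
  ArcWithin-head (path k t) Pk            = Pk
  ArcWithin-head (rung k r) (_ , _ , Pk′) = Pk′
  ArcWithin-head (jump k)   (_ , Pk′)     = Pk′

  link-within : ∀ {P R} e → ArcWithin P R e →
                Dir.WalkWithin (InWalls P R) (φ (vtail W e)) (φ (vhead W e))
  link-within {P} {R} e ok = Dir.walkWithin (link e) (link-walk e)
    (λ w∈ → classify e ok (on-link⇒ends⊎interior e (subst (_ ∈_) (sym (lverts≡vertices e)) w∈)))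
    where
    classify : ∀ e {w} → ArcWithin P R e →
               w ≡ φ (vtail W e) ⊎ w ≡ φ (vhead W e) ⊎ w ∈ interior e → InWalls P R w
    classify (path k t) Pk                (inj₁ refl)        = inj₁ (k , Pk , inj₁ (_ , refl))
    classify (path k t) Pk                (inj₂ (inj₁ refl)) = inj₁ (k , Pk , inj₁ (_ , refl))
    classify (path k t) Pk                (inj₂ (inj₂ w∈))   = inj₁ (k , Pk , inj₂ (inj₁ (t , w∈)))
    classify (rung k r) (_ , Pk , _)      (inj₁ refl)        = inj₁ (k , Pk , inj₁ (_ , refl))
    classify (rung k r) (_ , _ , Pk′)     (inj₂ (inj₁ refl)) = inj₁ (csuc k , Pk′ , inj₁ (_ , refl))
    classify (rung k r) (ρ , _ , _)       (inj₂ (inj₂ w∈))   = inj₂ (ρ , k , r , w∈)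
    classify (jump k)   (Pk , _)          (inj₁ refl)        = inj₁ (k , Pk , inj₁ (_ , refl))
    classify (jump k)   (_ , Pk′)         (inj₂ (inj₁ refl)) = inj₁ (_ , Pk′ , inj₁ (_ , refl))
    classify (jump k)   (Pk , _)          (inj₂ (inj₂ w∈))   = inj₁ (k , Pk , inj₂ (inj₂ w∈))

  links : List (VArc W) → List (Fin (A D))
  links = concatMap link

  liftWalk : ∀ {x es y} → VaultWalks.Walk x es y → Dir.Walk (φ x) (links es) (φ y)
  liftWalk {es = []}    refl       = refl
  liftWalk {es = e ∷ _} (refl , w) = Dir.walk-++ (link-walk e) (liftWalk w)

  lift : ∀ {P R x es y} → VaultWalks.Walk x es y → P (proj₁ x) → All (ArcWithin P R) es →
         Dir.WalkWithin (InWalls P R) (φ x) (φ y)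
  lift {P} {R} w Px oks = Dir.walkWithin _ (liftWalk w) (within w Px oks)
    where
    within : ∀ {x es y} → VaultWalks.Walk x es y → P (proj₁ x) → All (ArcWithin P R) es →
             ∀ {v} → v ∈ Dir.vertices (φ x) (links es) → InWalls P R v
    within {x} {[]} refl Px [] (here refl) = inj₁ (_ , Px , inj₁ (proj₂ x , refl))
    within {es = e ∷ es} (refl , w) _ (ok ∷ oks) v∈
      with Dir.∈-vertices-++⁻ (links es) (link-walk e) v∈
    ... | inj₁ v∈link = Dir.WalkWithin.within (link-within e ok) v∈link
    ... | inj₂ v∈rest = within w (ArcWithin-head e ok) oks v∈rest

  segment : (k : Fin (ℓ W)) (p n : ℕ) → p + n ≤ len W k → List (VArc W)
  segment k p zero    _ = []
  segment k p (suc n) h =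
    path k (fromℕ< (<-≤-trans (m<m+n p z<s) h))
    ∷ segment k (suc p) n (subst (_≤ len W k) (+-suc p n) h)

  segment-walk : ∀ k p n h (x y : Fin (suc (len W k))) → toℕ x ≡ p → toℕ y ≡ p + n →
                 VaultWalks.Walk (k , x) (segment k p n h) (k , y)
  segment-walk k p zero h x y x≡p y≡p+0 =
    cong (k ,_) (toℕ-injective (trans x≡p (trans (sym (+-identityʳ p)) (sym y≡p+0))))
  segment-walk k p (suc n) h x y x≡p y≡p+n =
    cong (k ,_) (toℕ-injective (trans (toℕ-inject₁ _) (trans (toℕ-fromℕ< _) (sym x≡p)))) ,
    segment-walk k (suc p) n _ _ y (cong suc (toℕ-fromℕ< _)) (trans y≡p+n (+-suc p n))

  segment-within : ∀ {P R} k p n h → P k → All (ArcWithin P R) (segment k p n h)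
  segment-within k p zero    h Pk = []
  segment-within k p (suc n) h Pk = Pk ∷ segment-within k (suc p) n _ Pk

  wallSegment : (k : Fin (ℓ W)) (x y : Fin (suc (len W k))) → toℕ x ≤ toℕ y → List (VArc W)
  wallSegment k x y x≤y =
    segment k (toℕ x) (toℕ y ∸ toℕ x) (subst (_≤ len W k) (sym (m+[n∸m]≡n x≤y)) (toℕ≤pred[n] y))

  wallSegment-walk : ∀ k x y x≤y → VaultWalks.Walk (k , x) (wallSegment k x y x≤y) (k , y)
  wallSegment-walk k x y x≤y = segment-walk k _ _ _ x y refl (sym (m+[n∸m]≡n x≤y))

  wallSegment-within : ∀ {P R} k x y x≤y → P k → All (ArcWithin P R) (wallSegment k x y x≤y)
  wallSegment-within k x y x≤y = segment-within k _ _ _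

  lastOnWall : (k : Fin (ℓ W)) → Fin (suc (len W k))
  lastOnWall k = fromℕ (len W k)

  ≤-lastOnWall : ∀ k (x : Fin (suc (len W k))) → toℕ x ≤ toℕ (lastOnWall k)
  ≤-lastOnWall k x = subst (toℕ x ≤_) (sym (toℕ-fromℕ (len W k))) (toℕ≤pred[n] x)

  wholeWall : Fin (ℓ W) → List (VArc W)
  wholeWall k = wallSegment k fzero (lastOnWall k) z≤n

  zigzag : Fin (ℓ W) → ℕ → List (VArc W)
  zigzag k zero    = []
  zigzag k (suc m) = wholeWall k ++ jump k ∷ zigzag (k ⊕ 2) m

  zigzag-walk : ∀ k m → VaultWalks.Walk (k , fzero) (zigzag k m) (k ⊕ (m + m) , fzero)
  zigzag-walk k zero    = refl
  zigzag-walk k (suc m) = VaultWalks.walk-++ (wallSegment-walk k fzero (lastOnWall k) z≤n)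
    (refl , subst (λ k′ → VaultWalks.Walk _ (zigzag (k ⊕ 2) m) (k′ , fzero)) (⊕-double k m)
                  (zigzag-walk (k ⊕ 2) m))

  zigzag-within : ∀ {P R} k m → (∀ s → s ≤ m → P (k ⊕ (s + s))) → All (ArcWithin P R) (zigzag k m)
  zigzag-within k zero    _      = []
  zigzag-within {P} k (suc m) P-even =
    ++⁺ (wallSegment-within k fzero (lastOnWall k) z≤n (P-even 0 z≤n))
    ((P-even 0 z≤n , P-even 1 (s≤s z≤n))
     ∷ zigzag-within (k ⊕ 2) m λ s s≤m → subst P (sym (⊕-double k s)) (P-even (suc s) (s≤s s≤m)))

  b≤c : ∀ k → toℕ (b W k) ≤ toℕ (c W k)
  b≤c k with bc-ok W k
  ... | inj₁ c≡b+1     = subst (toℕ (b W k) ≤_) (sym c≡b+1) (n≤1+n _)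
  ... | inj₂ (b≡c , _) = ≤-reflexive (cong toℕ b≡c)

  firstRung : (k : Fin (ℓ W)) → Fin (nR W k)
  firstRung k = fromℕ< (nR≥1 W k)

  ≤-firstRung : ∀ k {x : Fin (suc (len W k))} → toℕ x ≤ toℕ (c W k) →
                toℕ x ≤ toℕ (rFrom W k (firstRung k))
  ≤-firstRung k x≤c = ≤-trans x≤c (rFrom-ok W k (firstRung k))

  firstRung-≤c : ∀ k → toℕ (rTo W k (firstRung k)) ≤ toℕ (c W (csuc k))
  firstRung-≤c k = ≤-trans (rTo-ok W k (firstRung k)) (b≤c (csuc k))

  ladder : (k : Fin (ℓ W)) (x : Fin (suc (len W k))) → ℕ → toℕ x ≤ toℕ (c W k) → List (VArc W)
  ladder k x zero    _   = wallSegment k x (lastOnWall k) (≤-lastOnWall k x) ++ jump k ∷ []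
  ladder k x (suc n) x≤c = wallSegment k x (rFrom W k (firstRung k)) (≤-firstRung k x≤c)
    ++ rung k (firstRung k) ∷ ladder (csuc k) (rTo W k (firstRung k)) n (firstRung-≤c k)

  ladder-walk : ∀ k x n x≤c → VaultWalks.Walk (k , x) (ladder k x n x≤c) (k ⊕ n ⊕ 2 , fzero)
  ladder-walk k x zero    _   =
    VaultWalks.walk-++ (wallSegment-walk k x (lastOnWall k) (≤-lastOnWall k x)) (refl , refl)
  ladder-walk k x (suc n) x≤c =
    VaultWalks.walk-++ (wallSegment-walk k x (rFrom W k (firstRung k)) (≤-firstRung k x≤c))
      (refl , ladder-walk (csuc k) _ n (firstRung-≤c k))

  ladder-within : ∀ {P R} k x n x≤c → R → (∀ t → t ≤ n → P (k ⊕ t)) → P (k ⊕ n ⊕ 2) →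
                  All (ArcWithin P R) (ladder k x n x≤c)
  ladder-within k x zero    _   ρ P-steps P-end =
    ++⁺ (wallSegment-within k x (lastOnWall k) (≤-lastOnWall k x) (P-steps 0 z≤n))
        ((P-steps 0 z≤n , P-end) ∷ [])
  ladder-within k x (suc n) x≤c ρ P-steps P-end =
    ++⁺ (wallSegment-within k x (rFrom W k (firstRung k)) (≤-firstRung k x≤c) (P-steps 0 z≤n))
      ((ρ , P-steps 0 z≤n , P-steps 1 (s≤s z≤n))
       ∷ ladder-within (csuc k) _ n (firstRung-≤c k) ρ (λ t t≤n → P-steps (suc t) (s≤s t≤n)) P-end)

  jump∈ladder : ∀ k x n x≤c → jump (k ⊕ n) ∈ ladder k x n x≤c
  jump∈ladder k x zero    _   = ∈-++⁺ʳ (wallSegment k x (lastOnWall k) (≤-lastOnWall k x)) (here refl)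
  jump∈ladder k x (suc n) x≤c =
    ∈-++⁺ʳ (wallSegment k x (rFrom W k (firstRung k)) (≤-firstRung k x≤c))
           (there (jump∈ladder (csuc k) _ n (firstRung-≤c k)))

  jump-link≢[] : ∀ k → link (jump k) ≢ []
  jump-link≢[] k link≡[] with subst (λ as → Dir.Walk _ as _) link≡[] (link-walk (jump k))
  ... | φ≡ with ⊕-injective k {0} {2} (≤-trans z<s (ℓ≥5 W)) (≤-trans (s≤s (s≤s z<s)) (ℓ≥5 W))
                  (cong proj₁ (φ-inj _ _ φ≡))
  ... | ()

  links≢[] : ∀ {e es} → e ∈ es → link e ≢ [] → links es ≢ []
  links≢[] {e}  (here refl) link≢[] = link≢[] ∘ ++-conicalˡ (link e) _
  links≢[] {es = e′ ∷ _} (there e∈) link≢[] = links≢[] e∈ link≢[] ∘ ++-conicalʳ (link e′) _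

  alongWall : ∀ {k} (p : Fin (suc (len W k))) →
              Dir.WalkWithin (OnWall k) (φ (k , fzero)) (φ (k , p))
  alongWall {k} p = Dir.mapWithin onWall
      (lift (wallSegment-walk k fzero p z≤n) refl (wallSegment-within k fzero p z≤n refl))
    where
    onWall : ∀ {w} → InWalls (_≡ k) ⊥ w → OnWall k w
    onWall (inj₁ (_ , refl , on-k)) = on-k

  intoLink : ∀ {k w} e → OnWall k (φ (vtail W e)) → (∀ {v} → v ∈ interior e → OnWall k v) →
             w ∈ interior e → Dir.WalkWithin (OnWall k) (φ (vtail W e)) w
  intoLink {k} e on-tail on-interior w∈ =
    Dir.mapWithin onWall
      (Dir.prefixInner (link-walk e) (subst (λ vs → _ ∈ inner vs) (lverts≡vertices e) w∈))
    where
    onWall : ∀ {v} → v ≡ φ (vtail W e) ⊎ v ∈ inner (Dir.vertices _ (link e)) → OnWall k v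
    onWall (inj₁ refl) = on-tail
    onWall {v} (inj₂ v∈) = on-interior (subst (λ vs → v ∈ inner vs) (sym (lverts≡vertices e)) v∈)

  wallPrefix : ∀ {k w} → OnWall k w → Dir.WalkWithin (OnWall k) (φ (k , fzero)) w
  wallPrefix (inj₁ (p , refl)) = alongWall p
  wallPrefix {k} (inj₂ (inj₁ (t , w∈))) =
    alongWall (inject₁ t)
    Dir.++ʷ intoLink (path k t) (inj₁ (_ , refl)) (λ v∈ → inj₂ (inj₁ (t , v∈))) w∈
  wallPrefix {k} (inj₂ (inj₂ w∈)) =
    alongWall (lastOnWall k) Dir.++ʷ intoLink (jump k) (inj₁ (_ , refl)) (inj₂ ∘ inj₂) w∈

  module AcrossEvenGap (k : Fin (ℓ W)) (m : ℕ) (gap : suc (m + m) < ℓ W) where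

    CycleWall : Fin (ℓ W) → Set
    CycleWall k′ = ∃[ s ] (s ≤ m × k′ ≡ k ⊕ (s + s))

    n : ℕ
    n = ℓ W ∸ suc (suc (m + m))

    ℓ≡ : suc (suc (m + m)) + n ≡ ℓ W
    ℓ≡ = m+[n∸m]≡n gap

    cycleWalk : ∀ {x y} → OnWall k x → OnWall (k ⊕ (m + m)) y →
                Und.WalkWithin (InWalls CycleWall ⊥) x y
    cycleWalk on-x on-y =
      backward D (Dir.mapWithin (λ on → inj₁ (k , (0 , z≤n , refl) , on)) (wallPrefix on-x))
      Und.++ʷ forward D (lift (zigzag-walk k m) (0 , z≤n , refl)
                              (zigzag-within k m λ s s≤m → s , s≤m , refl))
      Und.++ʷ forward D (Dir.mapWithin (λ on → inj₁ (_ , (m , ≤-refl , refl) , on)) (wallPrefix on-y))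

    offset-off-cycle : ∀ o → o < ℓ W → (∀ s → s ≤ m → o ≢ s + s) → ¬ CycleWall (k ⊕ o)
    offset-off-cycle o o<ℓ o≢even (s , s≤m , k⊕o≡) =
      o≢even s s≤m (⊕-injective k o<ℓ 2s<ℓ k⊕o≡)
      where 2s<ℓ : s + s < ℓ W
            2s<ℓ = ≤-<-trans (+-mono-≤ s≤m s≤m) (<-trans (n<1+n (m + m)) gap)

    odd-off-cycle : ∀ s → s ≤ m → ¬ CycleWall (k ⊕ 1 ⊕ (s + s))
    odd-off-cycle s s≤m = subst (λ k′ → ¬ CycleWall k′) (⊕-+ k 1 (s + s))
      (offset-off-cycle (suc (s + s)) (≤-<-trans (s≤s (+-mono-≤ s≤m s≤m)) gap) λ s′ _ → odd≢even s s′)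

    far-off-cycle : ∀ t → t ≤ n → ¬ CycleWall (k ⊕ 1 ⊕ (m + m) ⊕ t)
    far-off-cycle t t≤n =
      subst (λ k′ → ¬ CycleWall k′) (trans (⊕-+ k (suc (m + m)) t) (cong (_⊕ t) (⊕-+ k 1 (m + m))))
        (offset-off-cycle (suc (m + m) + t) o<ℓ
          λ s s≤m eq → <-irrefl (sym eq) (s≤s (≤-trans (+-mono-≤ s≤m s≤m) (m≤m+n (m + m) t))))
      where o<ℓ : suc (m + m) + t < ℓ W
            o<ℓ = subst (suc (m + m) + t <_) ℓ≡ (s≤s (+-monoʳ-≤ (suc (m + m)) t≤n))

    dicycle-closes : k ⊕ 1 ⊕ (m + m) ⊕ n ⊕ 2 ≡ k ⊕ 1
    dicycle-closes = begin
        k ⊕ 1 ⊕ (m + m) ⊕ n ⊕ 2           ≡⟨ cong (λ k′ → k′ ⊕ n ⊕ 2) (sym (⊕-+ k 1 (m + m))) ⟩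
        k ⊕ suc (m + m) ⊕ n ⊕ 2           ≡⟨ cong (_⊕ 2) (sym (⊕-+ k (suc (m + m)) n)) ⟩
        k ⊕ (suc (m + m) + n) ⊕ 2         ≡⟨ sym (⊕-+ k (suc (m + m) + n) 2) ⟩
        k ⊕ (suc (m + m) + n + 2)         ≡⟨ cong (k ⊕_) (trans (+-suc (suc (m + m) + n) 1) (cong (_+ 1) ℓ≡)) ⟩
        k ⊕ (ℓ W + 1)                     ≡⟨ ⊕-+ k (ℓ W) 1 ⟩
        k ⊕ ℓ W ⊕ 1                       ≡⟨ cong (_⊕ 1) (⊕-period k) ⟩
        k ⊕ 1                             ∎
      where open ≡-Reasoning

    dicycleArcs : List (VArc W)
    dicycleArcs = zigzag (k ⊕ 1) m ++ ladder (k ⊕ 1 ⊕ (m + m)) fzero n z≤n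

    dicycleWalk : Dir.WalkWithin (InWalls (λ k′ → ¬ CycleWall k′) ⊤)
                                 (φ (k ⊕ 1 , fzero)) (φ (k ⊕ 1 , fzero))
    dicycleWalk = lift closed (odd-off-cycle 0 z≤n)
      (++⁺ (zigzag-within (k ⊕ 1) m odd-off-cycle)
           (ladder-within _ fzero n z≤n tt far-off-cycle
              (subst (λ k′ → ¬ CycleWall k′) (sym dicycle-closes) (odd-off-cycle 0 z≤n))))
      where
      closed : VaultWalks.Walk (k ⊕ 1 , fzero) dicycleArcs (k ⊕ 1 , fzero)
      closed = subst (λ k′ → VaultWalks.Walk (k ⊕ 1 , fzero) dicycleArcs (k′ , fzero)) dicycle-closes
        (VaultWalks.walk-++ (zigzag-walk (k ⊕ 1) m) (ladder-walk _ fzero n z≤n))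

    dicycle : Σ[ B ∈ Dicycle D ] Dicycle.cverts B ⊆ Dir.vertices _ (links dicycleArcs)
    dicycle = dicycle-in-closedWalk D (Dir.WalkWithin.walk dicycleWalk)
      (links≢[] (∈-++⁺ʳ (zigzag (k ⊕ 1) m) (jump∈ladder _ fzero n z≤n)) (jump-link≢[] _))

    dicycle-within : ∀ {w} → w ∈ Dicycle.cverts (proj₁ dicycle) →
                     InWalls (λ k′ → ¬ CycleWall k′) ⊤ w
    dicycle-within w∈ = Dir.WalkWithin.within dicycleWalk (proj₂ dicycle w∈)

    clasp : ∀ {α x y} → S α ≡ false → x ≢ y → Adj D α x → Adj D α y →
            OnWall k x → OnWall (k ⊕ (m + m)) y → Clasp D S 1 x y α
    clasp Sα x≢y αx αy on-x on-y = clasp-from-walk D S Sα x≢y αx αy (proj₁ dicycle) α∉B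
      (Und.mapWithin (λ on-cycle → InWalls-S on-cycle , InWalls-disjoint on-cycle ∘ dicycle-within)
                     (cycleWalk on-x on-y))
      where
      α∉B : _ ∉ Dicycle.cverts (proj₁ dicycle)
      α∉B α∈ with trans (sym (InWalls-S (dicycle-within α∈))) Sα
      ... | ()

  clasp-between-walls : ∀ {α u v i j} → S α ≡ false → u ≢ v → Adj D α u → Adj D α v →
                        OnWall i u → OnWall j v → j ≢ csuc i → i ≢ csuc j → Clasp D S 1 u v α
  clasp-between-walls {i = i} {j} Sα u≢v αu αv u-on-i v-on-j j≢i+1 i≢j+1
    with evenGap ℓ≡suc[t+t] i j j≢i+1 i≢j+1
  ... | inj₁ (m , gap , refl) = AcrossEvenGap.clasp i m gap Sα u≢v αu αv u-on-i v-on-j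
  ... | inj₂ (m , gap , refl) =
    clasp-sym D (AcrossEvenGap.clasp j m gap Sα (u≢v ∘ sym) αv αu v-on-j u-on-i)

lemma4 : (D : Digraph) (S : Fin (V D) → Bool) → IsUniqueNontrivialSC D S
       → (W : Vault) → ¬ HasNiche W → (σ : Subdivision D S W)
       → (α u v : Fin (V D)) → S α ≡ false → u ≢ v
       → Adj D α u → Adj D α v
       → (∃[ i ] ∃[ j ] (Subdivision.OnWall σ i u × Subdivision.OnWall σ j v
                         × j ≢ csuc i × i ≢ csuc j))
       → Clasp D S 1 u v α
lemma4 D S _ W _ σ α u v Sα u≢v αu αv (i , j , u-on-i , v-on-j , j≢i+1 , i≢j+1) =
  OnVault.clasp-between-walls D S W σ Sα u≢v αu αv u-on-i v-on-j j≢i+1 i≢j+1
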